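{- If $A\subseteq\mathbb{N}$ is quasicreative, then $\mathbb{N}\setminus A$ contains an infinite recursively enumerable subset.
   Context: $\varphi_0,\varphi_1,\ldots$ is a standard enumeration of the unary partial computable functions, $\mathcal{W}_e=\operatorname{dom}\varphi_e$, and $\mathfrak{P}_{\mathrm{fin}}(\mathbb{N})$ is the set of finite subsets of $\mathbb{N}$ with its standard computable coding. A recursively enumerable set $A$ is quasicreative if there is a computable $f\colon\mathbb{N}\to\mathfrak{P}_{\mathrm{fin}}(\mathbb{N})$ such that for all $e$: if $\mathcal{W}_e\subseteq\mathbb{N}\setminus A$ then $f(e)\subseteq\mathbb{N}\setminus A$ and some $z\in f(e)$ lies in $(\mathbb{N}\setminus A)\setminus\mathcal{W}_e$. -}

module Defs where

open import Data.Nat using (ℕ; zero; suc; _+_; _*_; _∸_; _^_; _≤_; _<_)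
open import Data.Nat.DivMod using (_/_; _%_)
open import Data.Product using (Σ; ∃; ∃-syntax; _×_; _,_; proj₁; proj₂)
open import Relation.Nullary using (¬_)
open import Relation.Binary.PropositionalEquality using (_≡_)

-- Pairing: the standard bijection ℕ × ℕ → ℕ,  ⟨a , b⟩ = 2^a (2b+1) - 1

pair : ℕ → ℕ → ℕ
pair a b = (2 ^ a) * (2 * b + 1) ∸ 1

-- its inverse, computed on m = n + 1 = 2^a (2b+1) by halving (with fuel)
split : ℕ → ℕ → ℕ × ℕ
split zero m = 0 , 0
split (suc f) m with m % 2
... | zero  = suc (proj₁ (split f (m / 2))) , proj₂ (split f (m / 2))
... | suc _ = 0 , m / 2

unpair : ℕ → ℕ × ℕ
unpair n = split (suc n) (suc n)

-- Programs: Kleene's unary basis for the partial recursive functions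
-- (with the pairing function above).

data Code : Set where
  czero csucc cfst csnd : Code
  ccomp cpair crec      : Code → Code → Code
  cmu                   : Code → Code

-- Big-step semantics:  Eval c x y  means  [[c]](x) ↓ = y.
--   ccomp f g = f ∘ g,  cpair f g = x ↦ ⟨f x , g x⟩,
--   crec f g : ⟨x,0⟩ ↦ f x ,  ⟨x,n+1⟩ ↦ g ⟨⟨x,n⟩, h⟨x,n⟩⟩,
--   cmu f : x ↦ least n with f⟨x,n⟩ = 0 and f⟨x,m⟩ ↓ for m < n.
data Eval : Code → ℕ → ℕ → Set where
  ev-zero : ∀ x → Eval czero x 0
  ev-succ : ∀ x → Eval csucc x (suc x)
  ev-fst  : ∀ a b → Eval cfst (pair a b) a
  ev-snd  : ∀ a b → Eval csnd (pair a b) b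
  ev-comp : ∀ {f g x y z} → Eval g x y → Eval f y z → Eval (ccomp f g) x z
  ev-pair : ∀ {f g x y z} → Eval f x y → Eval g x z → Eval (cpair f g) x (pair y z)
  ev-rec0 : ∀ {f g x y} → Eval f x y → Eval (crec f g) (pair x 0) y
  ev-recS : ∀ {f g x n y z} → Eval (crec f g) (pair x n) y →
            Eval g (pair (pair x n) y) z → Eval (crec f g) (pair x (suc n)) z
  ev-mu   : ∀ {f x n} → Eval f (pair x n) 0 →
            (∀ m → m < n → Σ ℕ λ k → Eval f (pair x m) (suc k)) →
            Eval (cmu f) x n

-- Gödel numbering (decoding): n ↦ tag n % 8, arguments from unpair (n / 8).
-- Arguments are < n, so fuel n suffices; decoding is surjective.

decodeF : ℕ → ℕ → Code
decodeF zero n = czero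
decodeF (suc k) n = sel (n % 8)
  where
  a = proj₁ (unpair (n / 8))
  b = proj₂ (unpair (n / 8))
  sel : ℕ → Code
  sel 0 = czero
  sel 1 = csucc
  sel 2 = cfst
  sel 3 = csnd
  sel 4 = ccomp (decodeF k a) (decodeF k b)
  sel 5 = cpair (decodeF k a) (decodeF k b)
  sel 6 = crec (decodeF k a) (decodeF k b)
  sel _ = cmu (decodeF k (n / 8))

decode : ℕ → Code
decode n = decodeF n n

_⟦_⟧↓_ : ℕ → ℕ → ℕ → Set
e ⟦ x ⟧↓ y = Eval (decode e) x y

W : ℕ → ℕ → Set
W e x = ∃[ y ] (e ⟦ x ⟧↓ y)

Pred : Set₁
Pred = ℕ → Set

_⊆_ : Pred → Pred → Set
P ⊆ Q = ∀ x → P x → Q x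

∁ : Pred → Pred
∁ P x = ¬ P x

RE : Pred → Set
RE A = ∃[ a ] (∀ x → (A x → W a x) × (W a x → A x))

Infinite : Pred → Set
Infinite P = ∀ n → ∃[ m ] (n ≤ m × P m)

-- Canonical coding of finite sets: D n = { z | bit z of n is 1 }
-- n shifted right by z bits, i.e. ⌊n / 2^z⌋
shiftR : ℕ → ℕ → ℕ
shiftR n zero    = n
shiftR n (suc z) = shiftR (n / 2) z

D : ℕ → Pred
D n z = shiftR n z % 2 ≡ 1

-- f : ℕ → Pfin(ℕ), represented by the codes of its values, is computable
Computable : (ℕ → ℕ) → Set
Computable f = ∃[ i ] (∀ e → i ⟦ e ⟧↓ f e)

Quasicreative : Pred → Set
Quasicreative A =
  RE A ×
  ∃[ f ] (Computable f ×
    (∀ e → W e ⊆ ∁ A →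
       (D (f e) ⊆ ∁ A) × ∃[ z ] (D (f e) z × ¬ A z × ¬ W e z)))

-- Let f witness quasicreativity of A.  Starting from the empty set
-- we build finite sets K₀ ⊆ K₁ ⊆ … ⊆ ∁A, given by canonical codes.  If
-- D k ⊆ ∁A and e is an index of a program with W e = D k, quasicreativity
-- says D (f e) ⊆ ∁A and D (f e) ⊄ D k; so the least z ∈ D (f e) ∖ D k lies
-- in ∁A, and the next stage is D (k + 2^z) = D k ∪ {z}.  The stage map
-- k ↦ k + 2^z is computable, hence so is n ↦ K n, and the set ⋃ₙ D (K n)
-- is the domain of the program  x ↦ μn. [x ∈ D (K n)].  It avoids A, and
-- it is infinite because the added elements z₀, z₁, … are pairwise distinct.
module Submission where

open import Defs
open import Data.Product using (Σ; ∃-syntax; _×_; _,_; proj₁; proj₂)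
open import Data.Product.Properties using (,-injective)
open import Function using (_∘′_)
open import Data.Sum using (_⊎_; inj₁; inj₂)
open import Data.Nat
open import Data.Nat.Properties
open import Data.Nat.DivMod
open import Data.Nat.Divisibility using (n∣m*n)
open import Data.Empty using (⊥; ⊥-elim)
open import Data.Fin using (Fin; toℕ; fromℕ<)
import Data.Fin.Properties as Fin
open import Relation.Nullary using (¬_; Dec; yes; no)
open import Relation.Binary using (tri<; tri≈; tri>)
open import Relation.Binary.PropositionalEquality

-- pair⁺ a b = 2^a (2b+1) is the successor of pair a b; arithmetic about
-- pairing is done on pair⁺, which avoids truncated subtraction.
pair⁺ : ℕ → ℕ → ℕ
pair⁺ a b = 2 ^ a * (2 * b + 1)

pair⁺≡suc-pair : ∀ a b → pair⁺ a b ≡ suc (pair a b)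
pair⁺≡suc-pair a b = trans (sym (m∸n+n≡m 1≤pair⁺)) (+-comm (pair⁺ a b ∸ 1) 1)
  where
  1≤pair⁺ : 1 ≤ pair⁺ a b
  1≤pair⁺ = *-mono-≤ (m^n>0 2 a) (m≤n+m 1 (2 * b))

pair⁺-zero : ∀ b → pair⁺ 0 b ≡ 1 + b * 2
pair⁺-zero b = trans (+-identityʳ (2 * b + 1)) (trans (+-comm (2 * b) 1) (cong suc (*-comm 2 b)))

pair⁺-suc : ∀ a b → pair⁺ (suc a) b ≡ pair⁺ a b * 2
pair⁺-suc a b = trans (*-assoc 2 (2 ^ a) (2 * b + 1)) (*-comm 2 (pair⁺ a b))

divMod-digit : ∀ d .{{_ : NonZero d}} t q → t < d →
               ((t + q * d) % d ≡ t) × ((t + q * d) / d ≡ q)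
divMod-digit d t q t<d =
  trans ([m+kn]%n≡m%n t q d) (m<n⇒m%n≡m t<d) ,
  trans (+-distrib-/-∣ʳ t (n∣m*n q)) (cong₂ _+_ (m<n⇒m/n≡0 t<d) (m*n/n≡m q d))

even-% : ∀ q → (q * 2) % 2 ≡ 0
even-% q = proj₁ (divMod-digit 2 0 q z<s)

even-/ : ∀ q → (q * 2) / 2 ≡ q
even-/ q = proj₂ (divMod-digit 2 0 q z<s)

odd-% : ∀ q → (1 + q * 2) % 2 ≡ 1
odd-% q = proj₁ (divMod-digit 2 1 q (s<s z<s))

odd-/ : ∀ q → (1 + q * 2) / 2 ≡ q
odd-/ q = proj₂ (divMod-digit 2 1 q (s<s z<s))

halve : ∀ n → ∃[ q ] ((n ≡ q * 2) ⊎ (n ≡ 1 + q * 2))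
halve zero = 0 , inj₁ refl
halve (suc n) with halve n
... | q , inj₁ e = q , inj₂ (cong suc e)
... | q , inj₂ e = suc q , inj₁ (cong suc e)

split-pair⁺ : ∀ fuel m a b → m ≡ pair⁺ a b → a < fuel → split fuel m ≡ (a , b)
split-pair⁺ (suc fuel) m a b m≡ (s≤s a≤fuel) with m % 2 in m%2
split-pair⁺ (suc fuel) m zero b m≡ _ | zero =
  ⊥-elim (0≢1+n (trans (sym m%2) (trans (cong (_% 2) (trans m≡ (pair⁺-zero b))) (odd-% b))))
split-pair⁺ (suc fuel) m (suc a) b m≡ (s≤s a≤fuel) | zero =
  cong₂ _,_ (cong (suc ∘′ proj₁) halved) (cong proj₂ halved)
  where
  halved : split fuel (m / 2) ≡ (a , b)
  halved = split-pair⁺ fuel (m / 2) a b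
             (trans (cong (_/ 2) (trans m≡ (pair⁺-suc a b))) (even-/ (pair⁺ a b))) a≤fuel
split-pair⁺ (suc fuel) m zero b m≡ _ | suc _ =
  cong (0 ,_) (trans (cong (_/ 2) (trans m≡ (pair⁺-zero b))) (odd-/ b))
split-pair⁺ (suc fuel) m (suc a) b m≡ _ | suc _ =
  ⊥-elim (1+n≢0 (trans (sym m%2) (trans (cong (_% 2) (trans m≡ (pair⁺-suc a b))) (even-% (pair⁺ a b)))))

a<pair⁺ : ∀ a b → a < pair⁺ a b
a<pair⁺ zero b = subst (0 <_) (sym (pair⁺-zero b)) z<s
a<pair⁺ (suc a) b = subst (suc a <_) (sym (pair⁺-suc a b))
  (≤-<-trans (a<pair⁺ a b) (m<m*n (pair⁺ a b) 2 {{>-nonZero (≤-<-trans z≤n (a<pair⁺ a b))}} ≤-refl))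

b<pair⁺ : ∀ a b → b < pair⁺ a b
b<pair⁺ zero b = subst (b <_) (sym (pair⁺-zero b)) (s≤s (m≤m*n b 2))
b<pair⁺ (suc a) b = subst (b <_) (sym (pair⁺-suc a b)) (≤-trans (b<pair⁺ a b) (m≤m*n (pair⁺ a b) 2))

a≤pair : ∀ a b → a ≤ pair a b
a≤pair a b = s≤s⁻¹ (subst (a <_) (pair⁺≡suc-pair a b) (a<pair⁺ a b))

b≤pair : ∀ a b → b ≤ pair a b
b≤pair a b = s≤s⁻¹ (subst (b <_) (pair⁺≡suc-pair a b) (b<pair⁺ a b))

unpair-pair : ∀ a b → unpair (pair a b) ≡ (a , b)
unpair-pair a b = split-pair⁺ (suc (pair a b)) (suc (pair a b)) a b
                    (sym (pair⁺≡suc-pair a b)) (s≤s (a≤pair a b))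

pair-injective : ∀ a b a′ b′ → pair a b ≡ pair a′ b′ → (a ≡ a′) × (b ≡ b′)
pair-injective a b a′ b′ e =
  ,-injective (trans (sym (unpair-pair a b)) (trans (cong unpair e) (unpair-pair a′ b′)))

pair⁺-surjective : ∀ fuel n → n ≤ fuel → ∃[ a ] ∃[ b ] (pair⁺ a b ≡ suc n)
pair⁺-surjective fuel n n≤fuel with halve n
... | q , inj₁ even = 0 , q , trans (pair⁺-zero q) (cong suc (sym even))
pair⁺-surjective zero n n≤0 | q , inj₂ odd with () ← trans (sym odd) (n≤0⇒n≡0 n≤0)
pair⁺-surjective (suc fuel) n n≤fuel | q , inj₂ odd
  with pair⁺-surjective fuel q (s≤s⁻¹ (≤-trans (s≤s (m≤m*n q 2)) (subst (_≤ suc fuel) odd n≤fuel)))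
... | a , b , e = suc a , b , trans (pair⁺-suc a b) (trans (cong (_* 2) e) (cong suc (sym odd)))

pair-surjective : ∀ x → ∃[ a ] ∃[ b ] (pair a b ≡ x)
pair-surjective x with pair⁺-surjective x x ≤-refl
... | a , b , e = a , b , suc-injective (trans (sym (pair⁺≡suc-pair a b)) e)

enc : Code → ℕ
enc czero       = 0
enc csucc       = 1
enc cfst        = 2
enc csnd        = 3
enc (ccomp f g) = 4 + pair (enc f) (enc g) * 8
enc (cpair f g) = 5 + pair (enc f) (enc g) * 8
enc (crec f g)  = 6 + pair (enc f) (enc g) * 8
enc (cmu f)     = 7 + enc f * 8

arg₁ arg₂ : ℕ → ℕ
arg₁ n = proj₁ (unpair (n / 8))
arg₂ n = proj₂ (unpair (n / 8))

unfold-ccomp : ∀ k n → n % 8 ≡ 4 → decodeF (suc k) n ≡ ccomp (decodeF k (arg₁ n)) (decodeF k (arg₂ n))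
unfold-ccomp k n tag rewrite tag = refl

unfold-cpair : ∀ k n → n % 8 ≡ 5 → decodeF (suc k) n ≡ cpair (decodeF k (arg₁ n)) (decodeF k (arg₂ n))
unfold-cpair k n tag rewrite tag = refl

unfold-crec : ∀ k n → n % 8 ≡ 6 → decodeF (suc k) n ≡ crec (decodeF k (arg₁ n)) (decodeF k (arg₂ n))
unfold-crec k n tag rewrite tag = refl

unfold-cmu : ∀ k n → n % 8 ≡ 7 → decodeF (suc k) n ≡ cmu (decodeF k (n / 8))
unfold-cmu k n tag rewrite tag = refl

decode-binary : ∀ t {k a b f g} {con : Code → Code → Code} → t < 8 →
  (∀ n → n % 8 ≡ t → decodeF (suc k) n ≡ con (decodeF k (arg₁ n)) (decodeF k (arg₂ n))) →
  decodeF k a ≡ f → decodeF k b ≡ g → decodeF (suc k) (t + pair a b * 8) ≡ con f g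
decode-binary t {k} {a} {b} {con = con} t<8 unfold a↦f b↦g =
  trans (unfold _ (proj₁ digit))
        (cong₂ con (trans (cong (decodeF k ∘′ proj₁) args) a↦f)
                   (trans (cong (decodeF k ∘′ proj₂) args) b↦g))
  where
  digit = divMod-digit 8 t (pair a b) t<8
  args : unpair ((t + pair a b * 8) / 8) ≡ (a , b)
  args = trans (cong unpair (proj₂ digit)) (unpair-pair a b)

code-arg< : ∀ t q k → suc t + q * 8 ≤ suc k → q ≤ k
code-arg< t q k le = ≤-trans (m≤m*n q 8) (≤-trans (m≤n+m (q * 8) t) (s≤s⁻¹ le))

decodeF-enc : ∀ c k → enc c ≤ k → decodeF k (enc c) ≡ c
decodeF-enc czero zero    _ = refl
decodeF-enc czero (suc k) _ = refl
decodeF-enc csucc (suc k) _ = refl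
decodeF-enc cfst  (suc k) _ = refl
decodeF-enc csnd  (suc k) _ = refl
decodeF-enc (ccomp f g) (suc k) le =
  decode-binary 4 (<ᵇ⇒< 4 8 _) (unfold-ccomp k)
    (decodeF-enc f k (≤-trans (a≤pair (enc f) (enc g)) (code-arg< 3 _ k le)))
    (decodeF-enc g k (≤-trans (b≤pair (enc f) (enc g)) (code-arg< 3 _ k le)))
decodeF-enc (cpair f g) (suc k) le =
  decode-binary 5 (<ᵇ⇒< 5 8 _) (unfold-cpair k)
    (decodeF-enc f k (≤-trans (a≤pair (enc f) (enc g)) (code-arg< 4 _ k le)))
    (decodeF-enc g k (≤-trans (b≤pair (enc f) (enc g)) (code-arg< 4 _ k le)))
decodeF-enc (crec f g) (suc k) le =
  decode-binary 6 (<ᵇ⇒< 6 8 _) (unfold-crec k)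
    (decodeF-enc f k (≤-trans (a≤pair (enc f) (enc g)) (code-arg< 5 _ k le)))
    (decodeF-enc g k (≤-trans (b≤pair (enc f) (enc g)) (code-arg< 5 _ k le)))
decodeF-enc (cmu f) (suc k) le =
  trans (unfold-cmu k _ (proj₁ digit))
        (cong cmu (trans (cong (decodeF k) (proj₂ digit)) (decodeF-enc f k (code-arg< 6 _ k le))))
  where
  digit = divMod-digit 8 7 (enc f) (<ᵇ⇒< 7 8 _)

decode-enc : ∀ c → decode (enc c) ≡ c
decode-enc c = decodeF-enc c (enc c) ≤-refl

W-enc : ∀ {c x} → W (enc c) x → ∃[ y ] Eval c x y
W-enc {c} {x} (y , ev) = y , subst (λ d → Eval d x y) (decode-enc c) ev

enc-W : ∀ {c x y} → Eval c x y → W (enc c) x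
enc-W {c} {x} {y} ev = y , subst (λ d → Eval d x y) (sym (decode-enc c)) ev

eval-deterministic : ∀ {c x x′ y y′} → Eval c x y → Eval c x′ y′ → x ≡ x′ → y ≡ y′
eval-deterministic (ev-zero _) (ev-zero _) _ = refl
eval-deterministic (ev-succ _) (ev-succ _) x≡x′ = cong suc x≡x′
eval-deterministic (ev-fst a b) (ev-fst a′ b′) x≡x′ = proj₁ (pair-injective a b a′ b′ x≡x′)
eval-deterministic (ev-snd a b) (ev-snd a′ b′) x≡x′ = proj₂ (pair-injective a b a′ b′ x≡x′)
eval-deterministic (ev-comp d₁ d₂) (ev-comp e₁ e₂) x≡x′ =
  eval-deterministic d₂ e₂ (eval-deterministic d₁ e₁ x≡x′)
eval-deterministic (ev-pair d₁ d₂) (ev-pair e₁ e₂) x≡x′ =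
  cong₂ pair (eval-deterministic d₁ e₁ x≡x′) (eval-deterministic d₂ e₂ x≡x′)
eval-deterministic (ev-rec0 {x = x} d) (ev-rec0 {x = x′} e) x≡x′ =
  eval-deterministic d e (proj₁ (pair-injective x 0 x′ 0 x≡x′))
eval-deterministic (ev-rec0 {x = x} _) (ev-recS {x = x′} {n = n′} _ _) x≡x′
  with () ← proj₂ (pair-injective x 0 x′ (suc n′) x≡x′)
eval-deterministic (ev-recS {x = x} {n = n} _ _) (ev-rec0 {x = x′} _) x≡x′
  with () ← proj₂ (pair-injective x (suc n) x′ 0 x≡x′)
eval-deterministic (ev-recS {x = x} {n = n} d₁ d₂) (ev-recS {x = x′} {n = n′} e₁ e₂) x≡x′
  with pair-injective x (suc n) x′ (suc n′) x≡x′
... | refl , refl = eval-deterministic d₂ e₂ (cong (pair (pair x n)) (eval-deterministic d₁ e₁ refl))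
eval-deterministic (ev-mu {n = n} d below) (ev-mu {n = n′} d′ below′) refl with <-cmp n n′
... | tri< n<n′ _ _ with () ← eval-deterministic d (proj₂ (below′ n n<n′)) refl
... | tri≈ _ n≡n′ _ = n≡n′
... | tri> _ _ n′<n with () ← eval-deterministic d′ (proj₂ (below n′ n′<n)) refl

-- Total programs for the arithmetic the construction needs.

_computes_ : Code → (ℕ → ℕ) → Set
c computes h = ∀ x → Eval c x (h x)

_computes₂_ : Code → (ℕ → ℕ → ℕ) → Set
c computes₂ h = ∀ x y → Eval c (pair x y) (h x y)

retarget : ∀ {c x y y′} → Eval c x y → y ≡ y′ → Eval c x y′
retarget ev refl = ev

idP : Code
idP = cpair cfst csnd

id-computes : idP computes (λ x → x)
id-computes x with pair-surjective x
... | a , b , refl = ev-pair (ev-fst a b) (ev-snd a b)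

constP : ℕ → Code
constP zero    = czero
constP (suc n) = ccomp csucc (constP n)

const-computes : ∀ n → constP n computes (λ _ → n)
const-computes zero    x = ev-zero x
const-computes (suc n) x = ev-comp (const-computes n x) (ev-succ n)

unaryP : Code → Code
unaryP r = ccomp r (cpair czero idP)

unary-computes : ∀ {r h} → r computes₂ (λ _ → h) → unaryP r computes h
unary-computes r-computes y = ev-comp (ev-pair (ev-zero y) (id-computes y)) (r-computes 0 y)

addP : Code
addP = crec idP (ccomp csucc csnd)

add-computes : addP computes₂ (λ x n → n + x)
add-computes x zero    = ev-rec0 {x = x} (id-computes x)
add-computes x (suc n) = ev-recS {x = x} {n = n} (add-computes x n)
  (ev-comp (ev-snd (pair x n) (n + x)) (ev-succ (n + x)))

mulP : Code
mulP = crec czero (ccomp addP (cpair csnd (ccomp cfst cfst)))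

mul-computes : mulP computes₂ (λ x k → k * x)
mul-computes x zero    = ev-rec0 {x = x} (ev-zero x)
mul-computes x (suc k) = ev-recS {x = x} {n = k} (mul-computes x k)
  (ev-comp (ev-pair (ev-snd (pair x k) (k * x)) (ev-comp (ev-fst (pair x k) (k * x)) (ev-fst x k)))
           (add-computes (k * x) x))

powR : Code
powR = crec (constP 1) (ccomp mulP (cpair csnd (constP 2)))

pow-computes₂ : powR computes₂ (λ _ z → 2 ^ z)
pow-computes₂ x zero    = ev-rec0 {x = x} (const-computes 1 x)
pow-computes₂ x (suc z) = ev-recS {x = x} {n = z} (pow-computes₂ x z)
  (ev-comp (ev-pair (ev-snd (pair x z) (2 ^ z)) (const-computes 2 (pair (pair x z) (2 ^ z))))
           (mul-computes (2 ^ z) 2))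

powP : Code
powP = unaryP powR

pow-computes : powP computes (2 ^_)
pow-computes = unary-computes pow-computes₂

tagP : ℕ → Code
tagP t = ccomp addP (cpair (ccomp mulP (cpair idP (constP 8))) (constP t))

tag-computes : ∀ t → tagP t computes (λ y → t + y * 8)
tag-computes t y = retarget
  (ev-comp (ev-pair (ev-comp (ev-pair (id-computes y) (const-computes 8 y)) (mul-computes y 8))
                    (const-computes t y))
           (add-computes (8 * y) t))
  (cong (t +_) (*-comm 8 y))

notR : Code
notR = crec (constP 1) czero

not-computes₂ : notR computes₂ (λ _ y → 1 ∸ y)
not-computes₂ x zero    = ev-rec0 {x = x} (const-computes 1 x)
not-computes₂ x (suc n) =
  retarget (ev-recS {x = x} {n = n} (not-computes₂ x n) (ev-zero (pair (pair x n) (1 ∸ n))))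
           (sym (0∸n≡0 n))

notP : Code
notP = unaryP notR

not-computes : notP computes (1 ∸_)
not-computes = unary-computes not-computes₂

-- Halving and parity are computed together, by recursion on y.
halfMod : ℕ → ℕ
halfMod y = pair (y / 2) (y % 2)

halfMod-suc : ∀ n → (suc n / 2 ≡ n % 2 + n / 2) × (suc n % 2 ≡ 1 ∸ n % 2)
halfMod-suc n with halve n
... | q , inj₁ refl = trans (odd-/ q) (cong₂ _+_ (sym (even-% q)) (sym (even-/ q))) ,
                      trans (odd-% q) (cong (1 ∸_) (sym (even-% q)))
... | q , inj₂ refl = trans (even-/ (suc q)) (cong₂ _+_ (sym (odd-% q)) (sym (odd-/ q))) ,
                      trans (even-% (suc q)) (cong (1 ∸_) (sym (odd-% q)))

halfModR : Code
halfModR = crec czero (cpair (ccomp addP csnd) (ccomp notP (ccomp csnd csnd)))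

halfMod-computes₂ : halfModR computes₂ (λ _ y → halfMod y)
halfMod-computes₂ x zero    = ev-rec0 {x = x} (ev-zero x)
halfMod-computes₂ x (suc n) = retarget
  (ev-recS {x = x} {n = n} (halfMod-computes₂ x n)
    (ev-pair (ev-comp (ev-snd (pair x n) (halfMod n)) (add-computes (n / 2) (n % 2)))
             (ev-comp (ev-comp (ev-snd (pair x n) (halfMod n)) (ev-snd (n / 2) (n % 2)))
                      (not-computes (n % 2)))))
  (sym (cong₂ pair (proj₁ (halfMod-suc n)) (proj₂ (halfMod-suc n))))

halfP : Code
halfP = ccomp cfst (unaryP halfModR)

half-computes : halfP computes (_/ 2)
half-computes y = ev-comp (unary-computes halfMod-computes₂ y) (ev-fst (y / 2) (y % 2))

modP : Code
modP = ccomp csnd (unaryP halfModR)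

mod-computes : modP computes (_% 2)
mod-computes y = ev-comp (unary-computes halfMod-computes₂ y) (ev-snd (y / 2) (y % 2))

shiftR-suc : ∀ n z → shiftR n (suc z) ≡ shiftR n z / 2
shiftR-suc n zero    = refl
shiftR-suc n (suc z) = shiftR-suc (n / 2) z

shiftRP : Code
shiftRP = crec idP (ccomp halfP csnd)

shiftR-computes : shiftRP computes₂ shiftR
shiftR-computes n zero    = ev-rec0 {x = n} (id-computes n)
shiftR-computes n (suc z) = retarget
  (ev-recS {x = n} {n = z} (shiftR-computes n z)
    (ev-comp (ev-snd (pair n z) (shiftR n z)) (half-computes (shiftR n z))))
  (sym (shiftR-suc n z))

bit : ℕ → ℕ → ℕ
bit n z = shiftR n z % 2

bitP : Code
bitP = ccomp modP shiftRP

bit-computes : bitP computes₂ bit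
bit-computes n z = ev-comp (shiftR-computes n z) (mod-computes (shiftR n z))

-- ⟨x , k⟩ ↦ 0 if x ∈ D k and 1 otherwise.  The program is opaque: its
-- index is a tower of exponentials, which must never be normalised when
-- indices built from it are compared.
opaque
  nonMemberP : Code
  nonMemberP = ccomp notP (ccomp bitP (cpair csnd cfst))

  nonMember-computes : nonMemberP computes₂ (λ x k → 1 ∸ bit k x)
  nonMember-computes x k =
    ev-comp (ev-comp (ev-pair (ev-snd x k) (ev-fst x k)) (bit-computes k x)) (not-computes (bit k x))

-- Unbounded search.

least : (R : ℕ → Set) → (∀ n → Dec (R n)) → ∀ w → R w →
        ∃[ n ] (R n × (∀ m → m < n → ¬ R m))
least R R? w r = go 0 (λ _ ()) w refl
  where
  -- search upwards from n, with d steps left before the witness w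
  go : ∀ n → (∀ m → m < n → ¬ R m) → ∀ d → n + d ≡ w → ∃[ n ] (R n × (∀ m → m < n → ¬ R m))
  go n below d n+d≡w with R? n
  ... | yes rn = n , rn , below
  go n below zero    n+0≡w | no ¬rn = ⊥-elim (¬rn (subst R (sym (trans (sym (+-identityʳ n)) n+0≡w)) r))
  go n below (suc d) n+d≡w | no ¬rn = go (suc n) below′ d (trans (sym (+-suc n d)) n+d≡w)
    where
    below′ : ∀ m → m < suc n → ¬ R m
    below′ m m<1+n with m ≟ n
    ... | yes refl = ¬rn
    ... | no m≢n = below m (≤∧≢⇒< (s≤s⁻¹ m<1+n) m≢n)

μ-halts : ∀ {g x} {h : ℕ → ℕ} → (∀ n → Eval g (pair x n) (h n)) →
          ∀ w → h w ≡ 0 → ∃[ n ] (h n ≡ 0 × Eval (cmu g) x n)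
μ-halts {g} {x} {h} g-computes w hw≡0 with least (λ n → h n ≡ 0) (λ n → h n ≟ 0) w hw≡0
... | n , hn≡0 , below = n , hn≡0 , ev-mu (retarget (g-computes n) hn≡0) positive
  where
  positive : ∀ m → m < n → ∃[ j ] Eval g (pair x m) (suc j)
  positive m m<n with h m in hm
  ... | zero  = ⊥-elim (below m m<n hm)
  ... | suc j = j , retarget (g-computes m) hm

μ-zero : ∀ {g x n} → Eval (cmu g) x n → Eval g (pair x n) 0
μ-zero (ev-mu g≡0 _) = g≡0

bit-cases : ∀ n z → (bit n z ≡ 0) ⊎ D n z
bit-cases n z with bit n z | m%n<n (shiftR n z) 2
... | zero          | _ = inj₁ refl
... | suc zero      | _ = inj₂ refl
... | suc (suc _)   | s≤s (s≤s ())

∉⇒bit≡0 : ∀ k z → ¬ D k z → bit k z ≡ 0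
∉⇒bit≡0 k z z∉ with bit-cases k z
... | inj₁ b≡0 = b≡0
... | inj₂ z∈  = ⊥-elim (z∉ z∈)

nonMember≡0⇒∈ : ∀ k x → 1 ∸ bit k x ≡ 0 → D k x
nonMember≡0⇒∈ k x eq with bit-cases k x
... | inj₂ x∈ = x∈
... | inj₁ b≡0 with () ← trans (cong (1 ∸_) (sym b≡0)) eq

D-empty : ∀ x → ¬ D 0 x
D-empty x x∈ = 0≢1+n (trans (sym (cong (_% 2) (shiftR-zero x))) x∈)
  where
  shiftR-zero : ∀ x → shiftR 0 x ≡ 0
  shiftR-zero zero    = refl
  shiftR-zero (suc x) = shiftR-zero x

insert-bit : ∀ z k → bit k z ≡ 0 → ∀ x →
             (x ≡ z → D (k + 2 ^ z) x) × (x ≢ z → bit (k + 2 ^ z) x ≡ bit k x)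
insert-bit (suc z) k _ zero = (λ ()) , λ _ →
  trans (cong (λ u → (k + u) % 2) (*-comm 2 (2 ^ z))) ([m+kn]%n≡m%n k (2 ^ z) 2)
insert-bit (suc z) k z∉ (suc x) =
  (λ x≡z → trans (cong (λ u → bit u x) halved) (proj₁ (insert-bit z (k / 2) z∉ x) (suc-injective x≡z))) ,
  (λ x≢z → trans (cong (λ u → bit u x) halved) (proj₂ (insert-bit z (k / 2) z∉ x) (x≢z ∘′ cong suc)))
  where
  halved : (k + 2 ^ suc z) / 2 ≡ k / 2 + 2 ^ z
  halved = trans (cong (λ u → (k + u) / 2) (*-comm 2 (2 ^ z)))
                 (trans (+-distrib-/-∣ʳ k (n∣m*n (2 ^ z))) (cong (k / 2 +_) (even-/ (2 ^ z))))
insert-bit zero k z∉ x with halve k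
insert-bit zero k z∉ x | q , inj₂ refl with () ← trans (sym (odd-% q)) z∉
insert-bit zero k z∉ zero    | q , inj₁ refl =
  (λ _ → trans (cong (_% 2) (+-comm (q * 2) 1)) (odd-% q)) , λ 0≢0 → ⊥-elim (0≢0 refl)
insert-bit zero k z∉ (suc x) | q , inj₁ refl = (λ ()) , λ _ →
  cong (λ u → bit u x) (trans (cong (_/ 2) (+-comm (q * 2) 1)) (trans (odd-/ q) (sym (even-/ q))))

∈-insert : ∀ z k → ¬ D k z → D (k + 2 ^ z) z
∈-insert z k z∉ = proj₁ (insert-bit z k (∉⇒bit≡0 k z z∉) z) refl

⊆-insert : ∀ z k → ¬ D k z → D k ⊆ D (k + 2 ^ z)
⊆-insert z k z∉ x x∈ = trans (proj₂ (insert-bit z k (∉⇒bit≡0 k z z∉) x) x≢z) x∈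
  where
  x≢z : x ≢ z
  x≢z refl = z∉ x∈

insert-⊆ : ∀ z k → ¬ D k z → ∀ x → D (k + 2 ^ z) x → (x ≡ z) ⊎ D k x
insert-⊆ z k z∉ x x∈ with x ≟ z
... | yes x≡z = inj₁ x≡z
... | no  x≢z = inj₂ (trans (sym (proj₂ (insert-bit z k (∉⇒bit≡0 k z z∉) x) x≢z)) x∈)

insert-avoids : ∀ (P : Pred) z k → ¬ P z → ¬ D k z → D k ⊆ ∁ P → D (k + 2 ^ z) ⊆ ∁ P
insert-avoids P z k z∉P z∉k avoids x x∈ with insert-⊆ z k z∉k x x∈
... | inj₁ refl = z∉P
... | inj₂ x∈k  = avoids x x∈k

-- Programs whose domains are finite sets (or unions of them).

unionP : Code → Code
unionP S = cmu (ccomp nonMemberP (cpair cfst S))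

module _ {S : Code} (s : ℕ → ℕ) (S-computes : ∀ x n → Eval S (pair x n) (s n)) where

  private
    test-computes : ∀ x n → Eval (ccomp nonMemberP (cpair cfst S)) (pair x n) (1 ∸ bit (s n) x)
    test-computes x n = ev-comp (ev-pair (ev-fst x n) (S-computes x n)) (nonMember-computes x (s n))

  W-union : ∀ x → W (enc (unionP S)) x → ∃[ n ] D (s n) x
  W-union x w =
    let n , halts = W-enc {unionP S} w
    in n , nonMember≡0⇒∈ (s n) x (eval-deterministic (test-computes x n) (μ-zero halts) refl)

  union-W : ∀ x n → D (s n) x → W (enc (unionP S)) x
  union-W x n x∈ = enc-W (proj₂ (proj₂ (μ-halts (test-computes x) n (cong (1 ∸_) x∈))))

memberP : ℕ → Code
memberP k = unionP (constP k)

W-member : ∀ k x → W (enc (memberP k)) x → D k x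
W-member k x w = proj₂ (W-union (λ _ → k) (λ x n → const-computes k (pair x n)) x w)

member-W : ∀ k x → D k x → W (enc (memberP k)) x
member-W k x x∈ = union-W (λ _ → k) (λ x n → const-computes k (pair x n)) x 0 x∈

constIndexR : Code
constIndexR = crec czero (ccomp (tagP 4) (cpair (constP 1) csnd))

constIndex-computes₂ : constIndexR computes₂ (λ _ k → enc (constP k))
constIndex-computes₂ x zero    = ev-rec0 {x = x} (ev-zero x)
constIndex-computes₂ x (suc k) = ev-recS {x = x} {n = k} (constIndex-computes₂ x k)
  (ev-comp (ev-pair (const-computes 1 (pair (pair x k) (enc (constP k))))
                    (ev-snd (pair x k) (enc (constP k))))
           (tag-computes 4 (pair 1 (enc (constP k)))))

-- The index of memberP k is computable from k (an instance of the s-m-n theorem):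
-- enc (memberP k) = 7 + (4 + ⟨enc nonMemberP , 5 + ⟨2 , enc (constP k)⟩·8⟩·8)·8.
memberIndexP : Code
memberIndexP = ccomp (tagP 7) (ccomp (tagP 4) (cpair (constP (enc nonMemberP))
                 (ccomp (tagP 5) (cpair (constP 2) (unaryP constIndexR)))))

memberIndex-computes : memberIndexP computes (λ k → enc (memberP k))
memberIndex-computes k = ev-comp
  (ev-comp (ev-pair (const-computes (enc nonMemberP) k)
                    (ev-comp (ev-pair (const-computes 2 k) (unary-computes constIndex-computes₂ k))
                             (tag-computes 5 (pair 2 (enc (constP k))))))
           (tag-computes 4 (pair (enc nonMemberP) (enc (cpair cfst (constP k))))))
  (tag-computes 7 (enc (ccomp nonMemberP (cpair cfst (constP k)))))

-- freshness k m z vanishes iff z ∈ D m ∖ D k.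
freshness : ℕ → ℕ → ℕ → ℕ
freshness k m z = (1 ∸ bit m z) + bit k z

freshnessP : Code
freshnessP = ccomp addP (cpair (ccomp bitP (cpair (ccomp cfst cfst) csnd))
                               (ccomp notP (ccomp bitP (cpair (ccomp csnd cfst) csnd))))

freshness-computes : ∀ k m z → Eval freshnessP (pair (pair k m) z) (freshness k m z)
freshness-computes k m z = ev-comp
  (ev-pair (ev-comp (ev-pair (ev-comp (ev-fst (pair k m) z) (ev-fst k m)) (ev-snd (pair k m) z))
                    (bit-computes k z))
           (ev-comp (ev-comp (ev-pair (ev-comp (ev-fst (pair k m) z) (ev-snd k m)) (ev-snd (pair k m) z))
                             (bit-computes m z))
                    (not-computes (bit m z))))
  (add-computes (bit k z) (1 ∸ bit m z))

searchP : Code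
searchP = cmu freshnessP

search-halts : ∀ k m z → D m z → ¬ D k z → ∃[ y ] (D m y × ¬ D k y × Eval searchP (pair k m) y)
search-halts k m z z∈m z∉k with μ-halts (freshness-computes k m) z fresh-z
  where
  fresh-z : freshness k m z ≡ 0
  fresh-z = cong₂ (λ u v → (1 ∸ u) + v) z∈m (∉⇒bit≡0 k z z∉k)
... | y , fresh-y , halts =
  y , nonMember≡0⇒∈ m y (m+n≡0⇒m≡0 (1 ∸ bit m y) fresh-y) ,
  (λ y∈k → 0≢1+n (trans (sym (m+n≡0⇒n≡0 (1 ∸ bit m y) fresh-y)) y∈k)) , halts

pigeonhole-ℕ : ∀ N (g : ℕ → ℕ) → (∀ j n → j < n → g j ≢ g n) → (∀ (j : Fin (suc N)) → g (toℕ j) < N) → ⊥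
pigeonhole-ℕ N g injective below with Fin.pigeonhole (n<1+n N) (λ j → fromℕ< (below j))
... | a , b , a<b , same = injective (toℕ a) (toℕ b) a<b
  (trans (sym (Fin.toℕ-fromℕ< (below a))) (trans (cong toℕ same) (Fin.toℕ-fromℕ< (below b))))

injective⇒infinite : (g : ℕ → ℕ) (P : Pred) → (∀ j n → j < n → g j ≢ g n) → (∀ n → P (g n)) → Infinite P
injective⇒infinite g P injective g∈P N with Fin.any? (λ (j : Fin (suc N)) → N ≤? g (toℕ j))
... | yes (j , N≤) = g (toℕ j) , N≤ , g∈P (toℕ j)
... | no none = ⊥-elim (pigeonhole-ℕ N g injective (λ j → ≰⇒> (λ N≤ → none (j , N≤))))

module Construction
  (A : Pred) (f : ℕ → ℕ) (i : ℕ) (i-computes-f : ∀ e → i ⟦ e ⟧↓ f e)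
  (quasicreative : ∀ e → W e ⊆ ∁ A →
                   (D (f e) ⊆ ∁ A) × ∃[ z ] (D (f e) z × ¬ A z × ¬ W e z))
  where

  Stage : Set
  Stage = Σ ℕ λ k → D k ⊆ ∁ A

  -- Quasicreativity at the index of D k gives D (f e) ⊆ ∁A and
  -- D (f e) ⊄ D k; searchP finds a point of D (f e) ∖ D k, hence of ∁A.
  fresh : (s : Stage) → ∃[ z ] (¬ A z × ¬ D (proj₁ s) z × Eval searchP (pair (proj₁ s) (f (enc (memberP (proj₁ s))))) z)
  fresh (k , avoids) =
    let D-f⊆∁A , z , z∈f , _ , z∉W = quasicreative (enc (memberP k)) (λ x w → avoids x (W-member k x w))
        y , y∈f , y∉k , found = search-halts k (f (enc (memberP k))) z z∈f (z∉W ∘′ member-W k z)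
    in y , D-f⊆∁A y y∈f , y∉k , found

  newPoint : Stage → ℕ
  newPoint s = proj₁ (fresh s)

  newPoint∉A : ∀ s → ¬ A (newPoint s)
  newPoint∉A s = proj₁ (proj₂ (fresh s))

  newPoint-new : ∀ s → ¬ D (proj₁ s) (newPoint s)
  newPoint-new s = proj₁ (proj₂ (proj₂ (fresh s)))

  newPoint-found : ∀ s → Eval searchP (pair (proj₁ s) (f (enc (memberP (proj₁ s))))) (newPoint s)
  newPoint-found s = proj₂ (proj₂ (proj₂ (fresh s)))

  next : Stage → Stage
  next s@(k , avoids) = k + 2 ^ newPoint s , insert-avoids A (newPoint s) k (newPoint∉A s) (newPoint-new s) avoids

  nextP : Code
  nextP = ccomp addP (cpair (ccomp powP (ccomp searchP (cpair idP (ccomp (decode i) memberIndexP)))) idP)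

  next-computes : ∀ s → Eval nextP (proj₁ s) (proj₁ (next s))
  next-computes s@(k , _) = ev-comp
    (ev-pair (ev-comp (ev-comp (ev-pair (id-computes k)
                                        (ev-comp (memberIndex-computes k) (i-computes-f (enc (memberP k)))))
                               (newPoint-found s))
                      (pow-computes (newPoint s)))
             (id-computes k))
    (add-computes (2 ^ newPoint s) k)

  stage : ℕ → Stage
  stage zero    = 0 , λ x x∈ _ → D-empty x x∈
  stage (suc n) = next (stage n)

  K : ℕ → ℕ
  K n = proj₁ (stage n)

  Z : ℕ → ℕ
  Z n = newPoint (stage n)

  stagesP : Code
  stagesP = crec czero (ccomp nextP csnd)

  stages-computes : stagesP computes₂ (λ _ n → K n)
  stages-computes x zero    = ev-rec0 {x = x} (ev-zero x)
  stages-computes x (suc n) = ev-recS {x = x} {n = n} (stages-computes x n)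
    (ev-comp (ev-snd (pair x n) (K n)) (next-computes (stage n)))

  enumeratorP : Code
  enumeratorP = unionP stagesP

  avoids : W (enc enumeratorP) ⊆ ∁ A
  avoids x w = let n , x∈ = W-union K stages-computes x w in proj₂ (stage n) x x∈

  Z-new : ∀ n → ¬ D (K n) (Z n)
  Z-new n = newPoint-new (stage n)

  Z-added : ∀ n → D (K (suc n)) (Z n)
  Z-added n = ∈-insert (Z n) (K n) (Z-new n)

  stages-grow : ∀ j d → D (K j) ⊆ D (K (d + j))
  stages-grow j zero    x x∈ = x∈
  stages-grow j (suc d) x x∈ = ⊆-insert (Z (d + j)) (K (d + j)) (Z-new (d + j)) x (stages-grow j d x x∈)

  -- Z j is in every later stage, while Z n is new at stage n.
  Z-injective : ∀ j n → j < n → Z j ≢ Z n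
  Z-injective j n j<n Zj≡Zn = Z-new n (subst (λ m → D (K m) (Z n)) (m∸n+n≡m j<n)
    (subst (D (K (n ∸ suc j + suc j))) Zj≡Zn (stages-grow (suc j) (n ∸ suc j) (Z j) (Z-added j))))

  infinite : Infinite (W (enc enumeratorP))
  infinite = injective⇒infinite Z (W (enc enumeratorP)) Z-injective
               (λ n → union-W K stages-computes (Z n) (suc n) (Z-added n))

mainTheorem7 : (A : Pred) → Quasicreative A → ∃[ e ] ((W e ⊆ ∁ A) × Infinite (W e))
mainTheorem7 A (_ , f , (i , i-computes-f) , quasicreative) = enc enumeratorP , avoids , infinite
  where open Construction A f i i-computes-f quasicreative
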